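{- Let $T$ be a labeled plane tree and let $e_1,e_2$ be edges of $T$. Then $\phi_{e_2}\phi_{e_1}(T)=\phi_{e_1}\phi_{e_2}(T)$, where in $\phi_{e_2}\phi_{e_1}(T)$ the map $\phi_{e_2}$ is applied to the edge of $\phi_{e_1}(T)$ corresponding to $e_2$, and similarly for the other composition.
   Context: A labeled plane tree is a rooted tree whose vertices carry distinct labels and in which the children of each vertex are linearly ordered left to right. Write $\tau_v$ for the subtree rooted at a vertex $v$. The map $\phi_e$: let $e=(i,j)$ be an edge of $T$, with $i$ the parent of $j$; let $i$ have children $k_1,\ldots,k_{t-1},j,k_{t+1},\ldots,k_p$ (left to right, $j$ the $t$-th), and let $j$ have children $l_1,\ldots,l_q$. Then $\phi_e(T)$ is obtained from $T$ as follows: the vertex $j$ takes the place of $i$ (it becomes the root if $i$ was the root, and otherwise becomes the child of $i$'s parent in the position previously occupied by $i$); the children of $j$ become, in order, $k_1,\ldots,k_{t-1},i,l_1,\ldots,l_q$ (with their subtrees unchanged); and the children of $i$ become, in order, $k_{t+1},\ldots,k_p$ (with subtrees unchanged). All other parts of $T$ are unchanged. Edges of $T$ correspond to edges of $\phi_e(T)$ as follows: $e=(i,j)$ corresponds to $(j,i)$; the edge from the parent $p$ of $i$ (if any) to $i$ corresponds to $(p,j)$; each edge $(i,k_s)$ with $s<t$ corresponds to $(j,k_s)$; every other edge corresponds to itself. -}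

module Defs where

open import Data.Nat using (ℕ; _≡ᵇ_)
open import Data.Bool using (Bool; true; false; if_then_else_; _∧_)
open import Data.List using (List; []; _∷_; _++_; map)
open import Data.Bool.ListAction using (any)
open import Data.Maybe using (Maybe; just; nothing; maybe)
import Data.Maybe as Maybe
open import Data.Product using (_×_; _,_)
open import Data.List.Relation.Unary.Any using (Any)
open import Relation.Binary.PropositionalEquality using (_≡_)

-- Plane trees with vertex labels in ℕ: a vertex with its ordered list of
-- children (left to right).
data Tree : Set where
  node : ℕ → List Tree → Tree

root : Tree → ℕ
root (node a _) = a

mutual
  labels : Tree → List ℕ
  labels (node a cs) = a ∷ labelsList cs

  labelsList : List Tree → List ℕ
  labelsList [] = []
  labelsList (c ∷ cs) = labels c ++ labelsList cs

-- Edge T i j : i is the parent of j in T.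
data Edge : Tree → ℕ → ℕ → Set where
  here  : ∀ {i cs j} → Any (λ c → root c ≡ j) cs → Edge (node i cs) i j
  there : ∀ {a cs i j} → Any (λ c → Edge c i j) cs → Edge (node a cs) i j

splitChildren : ℕ → List Tree → Maybe (List Tree × List Tree × List Tree)
splitChildren j [] = nothing
splitChildren j (node b ls ∷ cs) =
  if b ≡ᵇ j then just ([] , ls , cs)
  else Maybe.map (λ { (ks₁ , ls′ , ks₂) → (node b ls ∷ ks₁ , ls′ , ks₂) })
                 (splitChildren j cs)

mutual
  φ : ℕ → ℕ → Tree → Tree
  φ i j (node a cs) with a ≡ᵇ i | splitChildren j cs
  ... | true | just (ks₁ , ls , ks₂) = node j (ks₁ ++ node i ks₂ ∷ ls)
  ... | _    | _                     = node a (φList i j cs)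

  φList : ℕ → ℕ → List Tree → List Tree
  φList i j [] = []
  φList i j (c ∷ cs) = φ i j c ∷ φList i j cs

mutual
  childrenOf : ℕ → Tree → Maybe (List Tree)
  childrenOf i (node a cs) =
    if a ≡ᵇ i then just cs else childrenOfList i cs

  childrenOfList : ℕ → List Tree → Maybe (List Tree)
  childrenOfList i [] = nothing
  childrenOfList i (c ∷ cs) with childrenOf i c
  ... | just r  = just r
  ... | nothing = childrenOfList i cs

-- Labels k_1,…,k_{t-1} of the children of i to the left of j.
leftSiblings : Tree → ℕ → ℕ → List ℕ
leftSiblings T i j =
  maybe (λ cs → maybe (λ { (ks₁ , _ , _) → map root ks₁ }) [] (splitChildren j cs))
        [] (childrenOf i T)

-- The edge of φ_e(T) corresponding to the edge f of T, where e = (i , j).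
correspondingEdge : Tree → ℕ × ℕ → ℕ × ℕ → ℕ × ℕ
correspondingEdge T (i , j) (a , b) =
  if (a ≡ᵇ i) ∧ (b ≡ᵇ j) then (j , i)
  else if b ≡ᵇ i then (a , j)
  else if (a ≡ᵇ i) ∧ any (b ≡ᵇ_) (leftSiblings T i j) then (j , b)
  else (a , b)

φ′ : ℕ × ℕ → Tree → Tree
φ′ (i , j) = φ i j

-- φ_e only rearranges the children of the two endpoints of e and leaves every
-- other subtree intact; distinct labels make sure that φ, which finds vertices by
-- their labels, acts exactly there.
-- If neither edge leaves the root, both composites act inside the children of
-- the root: edges in a common child reduce to that child, and edges in different
-- children act on subtrees with disjoint labels, so each map ignores the other.
-- If e₁ = (a, j₁) leaves the root a, then e₂ is a sibling edge (a, j₂), the next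
-- edge (j₁, j₂) on a path, or an edge whose parent is neither a nor j₁; in each
-- case both composites are computed explicitly and give the same tree.

{-# OPTIONS --safe #-}
module Submission where

open import Defs
open import Data.Bool using (true; false; _∧_)
open import Data.Bool.Properties using (T-≡; ∨-zeroʳ)
open import Data.Bool.ListAction using (any)
open import Data.Empty using (⊥-elim)
open import Data.List using (List; []; _∷_; _++_; map)
open import Data.List.Properties using (++-assoc)
open import Data.List.Membership.Propositional using (_∈_; _∉_)
open import Data.List.Membership.Propositional.Properties using (∈-++⁺ˡ; ∈-++⁺ʳ; ∈-map⁺)
open import Data.List.Relation.Binary.Permutation.Propositional
  using (_↭_; ↭-prep; ↭-swap; ↭-refl; ↭-sym; module PermutationReasoning)
open import Data.List.Relation.Binary.Permutation.Propositional.Properties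
  using (∈-resp-↭; shift; ++⁺; ++⁺ˡ; ++-comm)
open import Data.List.Relation.Unary.All using (All; []; _∷_; lookup)
import Data.List.Relation.Unary.All as All
import Data.List.Relation.Unary.All.Properties as Allₚ
open import Data.List.Relation.Unary.Any using (Any; here; there)
import Data.List.Relation.Unary.Any.Properties as Anyₚ
open import Data.List.Relation.Unary.Unique.Propositional using (Unique; []; _∷_)
import Data.List.Relation.Unary.Unique.Propositional as Unique
open import Data.List.Relation.Unary.Unique.Propositional.Properties using (Unique[x∷xs]⇒x∉xs)
open import Data.Maybe using (just; nothing)
open import Data.Nat using (ℕ; _≡ᵇ_)
open import Data.Nat.Properties using (≡ᵇ⇒≡; _≟_)
open import Data.Product using (_×_; _,_; proj₁; proj₂)
open import Data.Sum using (_⊎_; inj₁; inj₂)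
open import Function using (_∘_; flip)
open import Function.Bundles using (module Equivalence)
open import Relation.Nullary using (yes; no)
open import Relation.Nullary.Decidable using (dec-true; dec-false)
open import Relation.Binary.PropositionalEquality

-- These rely on `does (m ≟ n)` being `m ≡ᵇ n` by definition of `_≟_`.
≡ᵇ-refl : ∀ n → (n ≡ᵇ n) ≡ true
≡ᵇ-refl n = dec-true (n ≟ n) refl

≢⇒≡ᵇ≡false : ∀ {m n} → m ≢ n → (m ≡ᵇ n) ≡ false
≢⇒≡ᵇ≡false {m} {n} = dec-false (m ≟ n)

≡ᵇ≡true⇒≡ : ∀ {m n} → (m ≡ᵇ n) ≡ true → m ≡ n
≡ᵇ≡true⇒≡ {m} {n} eq = ≡ᵇ⇒≡ m n (Equivalence.from T-≡ eq)

any-≡ᵇ-∈ : ∀ {b xs} → b ∈ xs → any (b ≡ᵇ_) xs ≡ true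
any-≡ᵇ-∈ {b} (here refl) rewrite ≡ᵇ-refl b = refl
any-≡ᵇ-∈ {b} {x ∷ _} (there b∈xs) rewrite any-≡ᵇ-∈ b∈xs = ∨-zeroʳ (b ≡ᵇ x)

any-≡ᵇ-∉ : ∀ {b} xs → b ∉ xs → any (b ≡ᵇ_) xs ≡ false
any-≡ᵇ-∉ [] _ = refl
any-≡ᵇ-∉ (x ∷ xs) b∉ rewrite ≢⇒≡ᵇ≡false (b∉ ∘ here) | any-≡ᵇ-∉ xs (b∉ ∘ there) = refl

Unique-++⁻ : ∀ {A : Set} (xs : List A) {ys} → Unique (xs ++ ys) → Unique xs × Unique ys
Unique-++⁻ [] u = [] , u
Unique-++⁻ (x ∷ xs) (x∉ ∷ u) = (Allₚ.++⁻ˡ xs x∉ ∷ proj₁ (Unique-++⁻ xs u)) , proj₂ (Unique-++⁻ xs u)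

Unique-++⇒disjoint : ∀ {A : Set} (xs : List A) {ys x} → Unique (xs ++ ys) → x ∈ ys → x ∉ xs
Unique-++⇒disjoint (_ ∷ xs) (y≢ ∷ _) x∈ys (here refl) = lookup (Allₚ.++⁻ʳ xs y≢) x∈ys refl
Unique-++⇒disjoint (_ ∷ xs) (_ ∷ u) x∈ys (there x∈xs) = Unique-++⇒disjoint xs u x∈ys x∈xs

labelsList-++ : ∀ A B → labelsList (A ++ B) ≡ labelsList A ++ labelsList B
labelsList-++ [] B = refl
labelsList-++ (c ∷ A) B =
  trans (cong (labels c ++_) (labelsList-++ A B)) (sym (++-assoc (labels c) _ _))

∈-labelsList-++⁺ˡ : ∀ {x} A {B} → x ∈ labelsList A → x ∈ labelsList (A ++ B)
∈-labelsList-++⁺ˡ A {B} x∈ = subst (_ ∈_) (sym (labelsList-++ A B)) (∈-++⁺ˡ x∈)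

∈-labelsList-++⁺ʳ : ∀ {x} A {B} → x ∈ labelsList B → x ∈ labelsList (A ++ B)
∈-labelsList-++⁺ʳ A {B} x∈ = subst (_ ∈_) (sym (labelsList-++ A B)) (∈-++⁺ʳ (labelsList A) x∈)

Unique-labelsList-++⁻ : ∀ A {B} → Unique (labelsList (A ++ B)) →
  Unique (labelsList A) × Unique (labelsList B)
Unique-labelsList-++⁻ A {B} u = Unique-++⁻ (labelsList A) (subst Unique (labelsList-++ A B) u)

Unique-labelsList-++⇒disjoint : ∀ A {B x} → Unique (labelsList (A ++ B)) →
  x ∈ labelsList B → x ∉ labelsList A
Unique-labelsList-++⇒disjoint A {B} u =
  Unique-++⇒disjoint (labelsList A) (subst Unique (labelsList-++ A B) u)

root∈labelsList : ∀ {j} cs → Any (λ c → root c ≡ j) cs → j ∈ labelsList cs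
root∈labelsList (node _ _ ∷ _) (here refl) = here refl
root∈labelsList (c ∷ cs) (there p) = ∈-++⁺ʳ (labels c) (root∈labelsList cs p)

∉labelsList⇒roots≢ : ∀ {b} A → b ∉ labelsList A → All (λ c → root c ≢ b) A
∉labelsList⇒roots≢ [] _ = []
∉labelsList⇒roots≢ (node a cs ∷ A) b∉ =
  (λ a≡b → b∉ (here (sym a≡b))) ∷ ∉labelsList⇒roots≢ A (b∉ ∘ ∈-++⁺ʳ (a ∷ labelsList cs))

roots-left-of≢ : ∀ A {j L B} → Unique (labelsList (A ++ node j L ∷ B)) → All (λ c → root c ≢ j) A
roots-left-of≢ A u = ∉labelsList⇒roots≢ A (Unique-labelsList-++⇒disjoint A u (here refl))

roots≢⇒∉roots : ∀ {b} {A : List Tree} → All (λ c → root c ≢ b) A → b ∉ map root A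
roots≢⇒∉roots (r≢b ∷ _) (here b≡r) = r≢b (sym b≡r)
roots≢⇒∉roots (_ ∷ rs) (there b∈) = roots≢⇒∉roots rs b∈

mutual
  edge-parent∈ : ∀ {t i j} → Edge t i j → i ∈ labels t
  edge-parent∈ (here _) = here refl
  edge-parent∈ (there p) = there (anyEdge-parent∈ p)

  anyEdge-parent∈ : ∀ {cs i j} → Any (λ c → Edge c i j) cs → i ∈ labelsList cs
  anyEdge-parent∈ (here e) = ∈-++⁺ˡ (edge-parent∈ e)
  anyEdge-parent∈ {c ∷ _} (there p) = ∈-++⁺ʳ (labels c) (anyEdge-parent∈ p)

mutual
  edge-child∈ : ∀ {t i j} → Edge t i j → j ∈ labels t
  edge-child∈ {node _ cs} (here p) = there (root∈labelsList cs p)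
  edge-child∈ (there p) = there (anyEdge-child∈ p)

  anyEdge-child∈ : ∀ {cs i j} → Any (λ c → Edge c i j) cs → j ∈ labelsList cs
  anyEdge-child∈ (here e) = ∈-++⁺ˡ (edge-child∈ e)
  anyEdge-child∈ {c ∷ _} (there p) = ∈-++⁺ʳ (labels c) (anyEdge-child∈ p)

data ChildView (j : ℕ) : List Tree → Set where
  child : ∀ A L B → ChildView j (A ++ node j L ∷ B)

childView : ∀ {j cs} → Any (λ c → root c ≡ j) cs → ChildView j cs
childView {cs = node _ L ∷ B} (here refl) = child [] L B
childView {cs = c ∷ _} (there p) with childView p
... | child A L B = child (c ∷ A) L B

data SiblingView (j₁ j₂ : ℕ) : List Tree → Set where
  left-of  : ∀ A L₁ M L₂ C → SiblingView j₁ j₂ (A ++ node j₁ L₁ ∷ M ++ node j₂ L₂ ∷ C)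
  right-of : ∀ A L₂ M L₁ C → SiblingView j₁ j₂ (A ++ node j₂ L₂ ∷ M ++ node j₁ L₁ ∷ C)

siblingView : ∀ {j₁ j₂ cs} → j₁ ≢ j₂ →
  Any (λ c → root c ≡ j₁) cs → Any (λ c → root c ≡ j₂) cs → SiblingView j₁ j₂ cs
siblingView j₁≢j₂ (here refl) (here refl) = ⊥-elim (j₁≢j₂ refl)
siblingView {cs = node _ L₁ ∷ _} _ (here refl) (there q) with childView q
... | child M L₂ C = left-of [] L₁ M L₂ C
siblingView {cs = node _ L₂ ∷ _} _ (there p) (here refl) with childView p
... | child M L₁ C = right-of [] L₂ M L₁ C
siblingView {cs = c ∷ _} j₁≢j₂ (there p) (there q) with siblingView j₁≢j₂ p q
... | left-of A L₁ M L₂ C = left-of (c ∷ A) L₁ M L₂ C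
... | right-of A L₂ M L₁ C = right-of (c ∷ A) L₂ M L₁ C

φList-++ : ∀ i j A B → φList i j (A ++ B) ≡ φList i j A ++ φList i j B
φList-++ i j [] B = refl
φList-++ i j (c ∷ A) B = cong (φ i j c ∷_) (φList-++ i j A B)

φ-skip : ∀ {i j a} cs → a ≢ i → φ i j (node a cs) ≡ node a (φList i j cs)
φ-skip cs a≢i rewrite ≢⇒≡ᵇ≡false a≢i = refl

mutual
  φ-fresh : ∀ {i j} t → i ∉ labels t → φ i j t ≡ t
  φ-fresh (node a cs) i∉ =
    trans (φ-skip cs (i∉ ∘ here ∘ sym)) (cong (node a) (φList-fresh cs (i∉ ∘ there)))

  φList-fresh : ∀ {i j} cs → i ∉ labelsList cs → φList i j cs ≡ cs
  φList-fresh [] _ = refl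
  φList-fresh (c ∷ cs) i∉ =
    cong₂ _∷_ (φ-fresh c (i∉ ∘ ∈-++⁺ˡ)) (φList-fresh cs (i∉ ∘ ∈-++⁺ʳ (labels c)))

φ²-fresh : ∀ {i j k l} t → i ∉ labels t → k ∉ labels t → φ k l (φ i j t) ≡ t
φ²-fresh t i∉ k∉ = trans (cong (φ _ _) (φ-fresh t i∉)) (φ-fresh t k∉)

φList²-fresh : ∀ {i j k l} cs → i ∉ labelsList cs → k ∉ labelsList cs →
  φList k l (φList i j cs) ≡ cs
φList²-fresh cs i∉ k∉ = trans (cong (φList _ _) (φList-fresh cs i∉)) (φList-fresh cs k∉)

splitChildren-sound : ∀ {j} cs {A L B} → splitChildren j cs ≡ just (A , L , B) →
  cs ≡ A ++ node j L ∷ B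
splitChildren-sound {j} (node b L ∷ cs) split with b ≡ᵇ j in b≡ᵇj
splitChildren-sound (node b L ∷ cs) refl | true = cong (λ b → node b L ∷ cs) (≡ᵇ≡true⇒≡ b≡ᵇj)
... | false with splitChildren j cs in split′
splitChildren-sound (c ∷ cs) refl | false | just _ = cong (c ∷_) (splitChildren-sound cs split′)

splitChildren-at : ∀ {j} A L B → All (λ c → root c ≢ j) A →
  splitChildren j (A ++ node j L ∷ B) ≡ just (A , L , B)
splitChildren-at {j} [] L B [] rewrite ≡ᵇ-refl j = refl
splitChildren-at (node _ _ ∷ A) L B (b≢j ∷ bs≢j)
  rewrite ≢⇒≡ᵇ≡false b≢j | splitChildren-at A L B bs≢j = refl

φ-split : ∀ {i j} cs {A L B} → splitChildren j cs ≡ just (A , L , B) →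
  φ i j (node i cs) ≡ node j (A ++ node i B ∷ L)
φ-split {i} cs split rewrite ≡ᵇ-refl i | split = refl

φ-rotate : ∀ {i j} A L B → All (λ c → root c ≢ j) A →
  φ i j (node i (A ++ node j L ∷ B)) ≡ node j (A ++ node i B ∷ L)
φ-rotate A L B roots≢j = φ-split (A ++ _) (splitChildren-at A L B roots≢j)

labels-rotate-↭ : ∀ i j A L B →
  labels (node j (A ++ node i B ∷ L)) ↭ labels (node i (A ++ node j L ∷ B))
labels-rotate-↭ i j A L B = begin
  j ∷ labelsList (A ++ node i B ∷ L)   ≡⟨ cong (j ∷_) (labelsList-++ A _) ⟩
  j ∷ lA ++ i ∷ lB ++ lL               ↭⟨ ↭-prep j (shift i lA _) ⟩
  j ∷ i ∷ lA ++ lB ++ lL               ↭⟨ ↭-swap j i ↭-refl ⟩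
  i ∷ j ∷ lA ++ lB ++ lL               ↭⟨ ↭-prep i (↭-sym (shift j lA _)) ⟩
  i ∷ lA ++ j ∷ lB ++ lL               ↭⟨ ↭-prep i (++⁺ˡ lA (↭-prep j (++-comm lB lL))) ⟩
  i ∷ lA ++ j ∷ lL ++ lB               ≡⟨ cong (i ∷_) (labelsList-++ A _) ⟨
  i ∷ labelsList (A ++ node j L ∷ B)   ∎
  where
  open PermutationReasoning
  lA = labelsList A
  lB = labelsList B
  lL = labelsList L

mutual
  labels-φ-↭ : ∀ i j t → labels (φ i j t) ↭ labels t
  labels-φ-↭ i j (node a cs) with a ≡ᵇ i in a≡ᵇi | splitChildren j cs in split
  ... | true | just (A , L , B)
    with refl ← ≡ᵇ≡true⇒≡ {a} {i} a≡ᵇi | refl ← splitChildren-sound cs split =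
      labels-rotate-↭ a j A L B
  ... | true | nothing = ↭-prep a (labelsList-φList-↭ i j cs)
  ... | false | _ = ↭-prep a (labelsList-φList-↭ i j cs)

  labelsList-φList-↭ : ∀ i j cs → labelsList (φList i j cs) ↭ labelsList cs
  labelsList-φList-↭ i j [] = ↭-refl
  labelsList-φList-↭ i j (c ∷ cs) = ++⁺ (labels-φ-↭ i j c) (labelsList-φList-↭ i j cs)

∉-φ : ∀ {x} i j t → x ∉ labels t → x ∉ labels (φ i j t)
∉-φ i j t x∉ = x∉ ∘ ∈-resp-↭ (labels-φ-↭ i j t)

∉-φList : ∀ {x} i j cs → x ∉ labelsList cs → x ∉ labelsList (φList i j cs)
∉-φList i j cs x∉ = x∉ ∘ ∈-resp-↭ (labelsList-φList-↭ i j cs)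

childrenOf-below : ∀ {i a} cs → a ≢ i → childrenOf i (node a cs) ≡ childrenOfList i cs
childrenOf-below cs a≢i rewrite ≢⇒≡ᵇ≡false a≢i = refl

mutual
  childrenOf-fresh : ∀ {i} t → i ∉ labels t → childrenOf i t ≡ nothing
  childrenOf-fresh (node a cs) i∉ =
    trans (childrenOf-below cs (i∉ ∘ here ∘ sym)) (childrenOfList-fresh cs (i∉ ∘ there))

  childrenOfList-fresh : ∀ {i} cs → i ∉ labelsList cs → childrenOfList i cs ≡ nothing
  childrenOfList-fresh [] _ = refl
  childrenOfList-fresh (c ∷ cs) i∉ rewrite childrenOf-fresh c (i∉ ∘ ∈-++⁺ˡ) =
    childrenOfList-fresh cs (i∉ ∘ ∈-++⁺ʳ (labels c))

childrenOfList-head : ∀ {i} c cs → i ∉ labelsList cs → childrenOfList i (c ∷ cs) ≡ childrenOf i c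
childrenOfList-head {i} c cs i∉ with childrenOf i c
... | just _ = refl
... | nothing = childrenOfList-fresh cs i∉

childrenOfList-tail : ∀ {i} c cs → i ∉ labels c → childrenOfList i (c ∷ cs) ≡ childrenOfList i cs
childrenOfList-tail c cs i∉ rewrite childrenOf-fresh c i∉ = refl

correspondingEdge-local : ∀ {T T′ i j} f → childrenOf i T ≡ childrenOf i T′ →
  correspondingEdge T (i , j) f ≡ correspondingEdge T′ (i , j) f
correspondingEdge-local f eq rewrite eq = refl

leftSiblings-split : ∀ {i j} cs {A L B} → splitChildren j cs ≡ just (A , L , B) →
  leftSiblings (node i cs) i j ≡ map root A
leftSiblings-split {i} cs split rewrite ≡ᵇ-refl i | split = refl

correspondingEdge-unrelated : ∀ T {i j a b} → a ≢ i → b ≢ i →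
  correspondingEdge T (i , j) (a , b) ≡ (a , b)
correspondingEdge-unrelated T a≢i b≢i rewrite ≢⇒≡ᵇ≡false a≢i | ≢⇒≡ᵇ≡false b≢i = refl

correspondingEdge-incoming : ∀ T {i j a} → a ≢ i → correspondingEdge T (i , j) (a , i) ≡ (a , j)
correspondingEdge-incoming T {i} a≢i rewrite ≢⇒≡ᵇ≡false a≢i | ≡ᵇ-refl i = refl

correspondingEdge-right-sibling : ∀ T {i j b} → b ≢ j → b ≢ i → b ∉ leftSiblings T i j →
  correspondingEdge T (i , j) (i , b) ≡ (i , b)
correspondingEdge-right-sibling T {i} b≢j b≢i b∉
  rewrite ≡ᵇ-refl i | ≢⇒≡ᵇ≡false b≢j | ≢⇒≡ᵇ≡false b≢i | any-≡ᵇ-∉ _ b∉ = refl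

correspondingEdge-left-sibling : ∀ T {i j b} → b ≢ j → b ≢ i → b ∈ leftSiblings T i j →
  correspondingEdge T (i , j) (i , b) ≡ (j , b)
correspondingEdge-left-sibling T {i} b≢j b≢i b∈
  rewrite ≡ᵇ-refl i | ≢⇒≡ᵇ≡false b≢j | ≢⇒≡ᵇ≡false b≢i | any-≡ᵇ-∈ b∈ = refl

correspondingEdge-parent∈ : ∀ T {S : List ℕ} i j a b → j ∈ S → a ∈ S →
  proj₁ (correspondingEdge T (i , j) (a , b)) ∈ S
correspondingEdge-parent∈ T i j a b j∈ a∈ with (a ≡ᵇ i) ∧ (b ≡ᵇ j)
... | true = j∈
... | false with b ≡ᵇ i
... | true = a∈
... | false with (a ≡ᵇ i) ∧ any (b ≡ᵇ_) (leftSiblings T i j)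
... | true = j∈
... | false = a∈

Commute : Tree → ℕ × ℕ → ℕ × ℕ → Set
Commute T e f = φ′ (correspondingEdge T e f) (φ′ e T) ≡ φ′ (correspondingEdge T f e) (φ′ f T)

commute-siblings : ∀ a A L₁ M L₂ C {j₁ j₂} →
  Unique (labels (node a (A ++ node j₁ L₁ ∷ M ++ node j₂ L₂ ∷ C))) →
  Commute (node a (A ++ node j₁ L₁ ∷ M ++ node j₂ L₂ ∷ C)) (a , j₁) (a , j₂)
commute-siblings a A L₁ M L₂ C {j₁} {j₂} u = trans lhs (sym rhs)
  where
  open ≡-Reasoning
  T = node a (A ++ node j₁ L₁ ∷ M ++ node j₂ L₂ ∷ C)
  result = node j₁ (A ++ node j₂ (M ++ node a C ∷ L₂) ∷ L₁)

  a∉ : a ∉ labelsList (A ++ node j₁ L₁ ∷ M ++ node j₂ L₂ ∷ C)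
  a∉ = Unique[x∷xs]⇒x∉xs u
  A≢j₁ : All (λ c → root c ≢ j₁) A
  A≢j₁ = roots-left-of≢ A (Unique.tail u)
  AM≢j₂ : All (λ c → root c ≢ j₂) (A ++ node j₁ L₁ ∷ M)
  AM≢j₂ = roots-left-of≢ (A ++ node j₁ L₁ ∷ M)
            (subst (Unique ∘ labelsList) (sym (++-assoc A (node j₁ L₁ ∷ M) _)) (Unique.tail u))
  j₁≢j₂ : j₁ ≢ j₂
  j₁≢j₂ = All.head (Allₚ.++⁻ʳ A AM≢j₂)
  a≢j₁ : a ≢ j₁
  a≢j₁ refl = a∉ (∈-labelsList-++⁺ʳ A (here refl))
  a≢j₂ : a ≢ j₂
  a≢j₂ refl =
    a∉ (∈-labelsList-++⁺ʳ A (there (∈-++⁺ʳ (labelsList L₁) (∈-labelsList-++⁺ʳ M (here refl)))))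

  split₁ : splitChildren j₁ (A ++ node j₁ L₁ ∷ M ++ node j₂ L₂ ∷ C)
         ≡ just (A , L₁ , M ++ node j₂ L₂ ∷ C)
  split₁ = splitChildren-at A L₁ _ A≢j₁
  split₂ : splitChildren j₂ (A ++ node j₁ L₁ ∷ M ++ node j₂ L₂ ∷ C)
         ≡ just (A ++ node j₁ L₁ ∷ M , L₂ , C)
  split₂ = subst (λ cs → splitChildren j₂ cs ≡ just _) (++-assoc A (node j₁ L₁ ∷ M) _)
             (splitChildren-at _ L₂ C AM≢j₂)

  j₂-right-of-j₁ : j₂ ∉ leftSiblings T a j₁
  j₂-right-of-j₁ = subst (j₂ ∉_) (sym (leftSiblings-split {a} _ split₁))
                     (roots≢⇒∉roots (Allₚ.++⁻ˡ A AM≢j₂))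
  j₁-left-of-j₂ : j₁ ∈ leftSiblings T a j₂
  j₁-left-of-j₂ = subst (j₁ ∈_) (sym (leftSiblings-split {a} _ split₂))
                     (∈-map⁺ root (∈-++⁺ʳ A (here refl)))

  lhs : φ′ (correspondingEdge T (a , j₁) (a , j₂)) (φ a j₁ T) ≡ result
  lhs = begin
    φ′ (correspondingEdge T (a , j₁) (a , j₂)) (φ a j₁ T)
      ≡⟨ cong (λ f → φ′ f (φ a j₁ T))
           (correspondingEdge-right-sibling T (j₁≢j₂ ∘ sym) (a≢j₂ ∘ sym) j₂-right-of-j₁) ⟩
    φ a j₂ (φ a j₁ T)
      ≡⟨ cong (φ a j₂) (φ-split _ split₁) ⟩
    φ a j₂ (node j₁ (A ++ node a (M ++ node j₂ L₂ ∷ C) ∷ L₁))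
      ≡⟨ φ-skip _ (a≢j₁ ∘ sym) ⟩
    node j₁ (φList a j₂ (A ++ node a (M ++ node j₂ L₂ ∷ C) ∷ L₁))
      ≡⟨ cong (node j₁) (φList-++ a j₂ A _) ⟩
    node j₁ (φList a j₂ A ++ φ a j₂ (node a (M ++ node j₂ L₂ ∷ C)) ∷ φList a j₂ L₁)
      ≡⟨ cong₂ (λ X Y → node j₁ (X ++ Y))
           (φList-fresh A (a∉ ∘ ∈-labelsList-++⁺ˡ A))
           (cong₂ _∷_ (φ-rotate M L₂ C (All.tail (Allₚ.++⁻ʳ A AM≢j₂)))
                      (φList-fresh L₁ (a∉ ∘ ∈-labelsList-++⁺ʳ A ∘ there ∘ ∈-++⁺ˡ))) ⟩
    result ∎

  rhs : φ′ (correspondingEdge T (a , j₂) (a , j₁)) (φ a j₂ T) ≡ result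
  rhs = begin
    φ′ (correspondingEdge T (a , j₂) (a , j₁)) (φ a j₂ T)
      ≡⟨ cong (λ f → φ′ f (φ a j₂ T))
           (correspondingEdge-left-sibling T j₁≢j₂ (a≢j₁ ∘ sym) j₁-left-of-j₂) ⟩
    φ j₂ j₁ (φ a j₂ T)
      ≡⟨ cong (φ j₂ j₁) (φ-split _ split₂) ⟩
    φ j₂ j₁ (node j₂ ((A ++ node j₁ L₁ ∷ M) ++ node a C ∷ L₂))
      ≡⟨ cong (φ j₂ j₁ ∘ node j₂) (++-assoc A _ _) ⟩
    φ j₂ j₁ (node j₂ (A ++ node j₁ L₁ ∷ M ++ node a C ∷ L₂))
      ≡⟨ φ-rotate A L₁ _ A≢j₁ ⟩
    result ∎

commute-path : ∀ a A P Q R B {j₁ j₂} →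
  Unique (labels (node a (A ++ node j₁ (P ++ node j₂ Q ∷ R) ∷ B))) →
  Commute (node a (A ++ node j₁ (P ++ node j₂ Q ∷ R) ∷ B)) (a , j₁) (j₁ , j₂)
commute-path a A P Q R B {j₁} {j₂} u = trans lhs (sym rhs)
  where
  open ≡-Reasoning
  L = P ++ node j₂ Q ∷ R
  T = node a (A ++ node j₁ L ∷ B)
  result = node j₂ (A ++ node a B ∷ P ++ node j₁ R ∷ Q)

  a∉ : a ∉ labelsList (A ++ node j₁ L ∷ B)
  a∉ = Unique[x∷xs]⇒x∉xs u
  j₁∉A : j₁ ∉ labelsList A
  j₁∉A = Unique-labelsList-++⇒disjoint A (Unique.tail u) (here refl)
  j₁-subtree : Unique (labels (node j₁ L) ++ labelsList B)
  j₁-subtree = proj₂ (Unique-labelsList-++⁻ A (Unique.tail u))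
  j₁∉B : j₁ ∉ labelsList B
  j₁∉B = Unique[x∷xs]⇒x∉xs j₁-subtree ∘ ∈-++⁺ʳ (labelsList L)
  A≢j₂ : All (λ c → root c ≢ j₂) A
  A≢j₂ = ∉labelsList⇒roots≢ A (Unique-labelsList-++⇒disjoint A (Unique.tail u)
           (there (∈-++⁺ˡ (∈-labelsList-++⁺ʳ P (here refl)))))
  P≢j₂ : All (λ c → root c ≢ j₂) P
  P≢j₂ = roots-left-of≢ P (proj₁ (Unique-++⁻ (labelsList L) (Unique.tail j₁-subtree)))

  a≢j₁ : a ≢ j₁
  a≢j₁ refl = a∉ (∈-labelsList-++⁺ʳ A (here refl))
  a≢j₂ : a ≢ j₂
  a≢j₂ refl = a∉ (∈-labelsList-++⁺ʳ A (there (∈-++⁺ˡ (∈-labelsList-++⁺ʳ P (here refl)))))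

  lhs : φ′ (correspondingEdge T (a , j₁) (j₁ , j₂)) (φ a j₁ T) ≡ result
  lhs = begin
    φ′ (correspondingEdge T (a , j₁) (j₁ , j₂)) (φ a j₁ T)
      ≡⟨ cong (λ f → φ′ f (φ a j₁ T)) (correspondingEdge-unrelated T (a≢j₁ ∘ sym) (a≢j₂ ∘ sym)) ⟩
    φ j₁ j₂ (φ a j₁ T)
      ≡⟨ cong (φ j₁ j₂) (φ-rotate A L B (∉labelsList⇒roots≢ A j₁∉A)) ⟩
    φ j₁ j₂ (node j₁ (A ++ node a B ∷ P ++ node j₂ Q ∷ R))
      ≡⟨ cong (φ j₁ j₂ ∘ node j₁) (++-assoc A (node a B ∷ P) _) ⟨
    φ j₁ j₂ (node j₁ ((A ++ node a B ∷ P) ++ node j₂ Q ∷ R))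
      ≡⟨ φ-rotate (A ++ node a B ∷ P) Q R (Allₚ.++⁺ A≢j₂ (a≢j₂ ∷ P≢j₂)) ⟩
    node j₂ ((A ++ node a B ∷ P) ++ node j₁ R ∷ Q)
      ≡⟨ cong (node j₂) (++-assoc A _ _) ⟩
    result ∎

  rhs : φ′ (correspondingEdge T (j₁ , j₂) (a , j₁)) (φ j₁ j₂ T) ≡ result
  rhs = begin
    φ′ (correspondingEdge T (j₁ , j₂) (a , j₁)) (φ j₁ j₂ T)
      ≡⟨ cong (λ f → φ′ f (φ j₁ j₂ T)) (correspondingEdge-incoming T a≢j₁) ⟩
    φ a j₂ (φ j₁ j₂ T)
      ≡⟨ cong (φ a j₂) (φ-skip _ a≢j₁) ⟩
    φ a j₂ (node a (φList j₁ j₂ (A ++ node j₁ L ∷ B)))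
      ≡⟨ cong (φ a j₂ ∘ node a) (φList-++ j₁ j₂ A _) ⟩
    φ a j₂ (node a (φList j₁ j₂ A ++ φ j₁ j₂ (node j₁ L) ∷ φList j₁ j₂ B))
      ≡⟨ cong₂ (λ X Y → φ a j₂ (node a (X ++ Y)))
           (φList-fresh A j₁∉A) (cong₂ _∷_ (φ-rotate P Q R P≢j₂) (φList-fresh B j₁∉B)) ⟩
    φ a j₂ (node a (A ++ node j₂ (P ++ node j₁ R ∷ Q) ∷ B))
      ≡⟨ φ-rotate A _ B A≢j₂ ⟩
    result ∎

commute-root-edge-unrelated : ∀ a A L B {j₁ i₂ j₂} → a ≢ i₂ → a ≢ j₂ → j₁ ≢ i₂ →
  j₁ ∉ labelsList A → Commute (node a (A ++ node j₁ L ∷ B)) (a , j₁) (i₂ , j₂)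
commute-root-edge-unrelated a A L B {j₁} {i₂} {j₂} a≢i₂ a≢j₂ j₁≢i₂ j₁∉A = trans lhs (sym rhs)
  where
  open ≡-Reasoning
  T = node a (A ++ node j₁ L ∷ B)
  φ₂ = φList i₂ j₂
  result = node j₁ (φ₂ A ++ node a (φ₂ B) ∷ φ₂ L)

  lhs : φ′ (correspondingEdge T (a , j₁) (i₂ , j₂)) (φ a j₁ T) ≡ result
  lhs = begin
    φ′ (correspondingEdge T (a , j₁) (i₂ , j₂)) (φ a j₁ T)
      ≡⟨ cong (λ f → φ′ f (φ a j₁ T)) (correspondingEdge-unrelated T (a≢i₂ ∘ sym) (a≢j₂ ∘ sym)) ⟩
    φ i₂ j₂ (φ a j₁ T)
      ≡⟨ cong (φ i₂ j₂) (φ-rotate A L B (∉labelsList⇒roots≢ A j₁∉A)) ⟩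
    φ i₂ j₂ (node j₁ (A ++ node a B ∷ L))
      ≡⟨ φ-skip _ j₁≢i₂ ⟩
    node j₁ (φ₂ (A ++ node a B ∷ L))
      ≡⟨ cong (node j₁) (φList-++ i₂ j₂ A _) ⟩
    node j₁ (φ₂ A ++ φ i₂ j₂ (node a B) ∷ φ₂ L)
      ≡⟨ cong (λ t → node j₁ (φ₂ A ++ t ∷ φ₂ L)) (φ-skip B a≢i₂) ⟩
    result ∎

  rhs : φ′ (correspondingEdge T (i₂ , j₂) (a , j₁)) (φ i₂ j₂ T) ≡ result
  rhs = begin
    φ′ (correspondingEdge T (i₂ , j₂) (a , j₁)) (φ i₂ j₂ T)
      ≡⟨ cong (λ f → φ′ f (φ i₂ j₂ T)) (correspondingEdge-unrelated T a≢i₂ j₁≢i₂) ⟩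
    φ a j₁ (φ i₂ j₂ T)
      ≡⟨ cong (φ a j₁) (φ-skip _ a≢i₂) ⟩
    φ a j₁ (node a (φ₂ (A ++ node j₁ L ∷ B)))
      ≡⟨ cong (φ a j₁ ∘ node a) (φList-++ i₂ j₂ A _) ⟩
    φ a j₁ (node a (φ₂ A ++ φ i₂ j₂ (node j₁ L) ∷ φ₂ B))
      ≡⟨ cong (λ t → φ a j₁ (node a (φ₂ A ++ t ∷ φ₂ B))) (φ-skip L j₁≢i₂) ⟩
    φ a j₁ (node a (φ₂ A ++ node j₁ (φ₂ L) ∷ φ₂ B))
      ≡⟨ φ-rotate (φ₂ A) _ _ (∉labelsList⇒roots≢ (φ₂ A) (∉-φList i₂ j₂ A j₁∉A)) ⟩
    result ∎

φList′ : ℕ × ℕ → List Tree → List Tree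
φList′ (i , j) = φList i j

CommuteIn : Tree → List Tree → ℕ × ℕ → ℕ × ℕ → Set
CommuteIn T cs e f =
  φList′ (correspondingEdge T e f) (φList′ e cs) ≡ φList′ (correspondingEdge T f e) (φList′ f cs)

commute-separate-children : ∀ T c cs {i₁ j₁ i₂ j₂} →
  (∀ {x} → x ∈ labels c → x ∉ labelsList cs) →
  Edge c i₁ j₁ → Any (λ d → Edge d i₂ j₂) cs → CommuteIn T (c ∷ cs) (i₁ , j₁) (i₂ , j₂)
commute-separate-children T c cs {i₁} {j₁} {i₂} {j₂} disjoint e₁ e₂ = trans lhs (sym rhs)
  where
  open ≡-Reasoning
  i₁∉cs : i₁ ∉ labelsList cs
  i₁∉cs = disjoint (edge-parent∈ e₁)
  i₂∉c : i₂ ∉ labels c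
  i₂∉c i₂∈c = disjoint i₂∈c (anyEdge-parent∈ e₂)
  separate : ∀ {x y} → x ∈ labels c → y ∈ labelsList cs → y ≢ x
  separate x∈c y∈cs refl = disjoint x∈c y∈cs

  lhs : φList′ (correspondingEdge T (i₁ , j₁) (i₂ , j₂)) (φList i₁ j₁ (c ∷ cs))
        ≡ φ i₁ j₁ c ∷ φList i₂ j₂ cs
  lhs = begin
    φList′ (correspondingEdge T (i₁ , j₁) (i₂ , j₂)) (φList i₁ j₁ (c ∷ cs))
      ≡⟨ cong (λ f → φList′ f (φList i₁ j₁ (c ∷ cs)))
           (correspondingEdge-unrelated T (separate (edge-parent∈ e₁) (anyEdge-parent∈ e₂))
                                          (separate (edge-parent∈ e₁) (anyEdge-child∈ e₂))) ⟩
    φ i₂ j₂ (φ i₁ j₁ c) ∷ φList i₂ j₂ (φList i₁ j₁ cs)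
      ≡⟨ cong₂ _∷_ (φ-fresh _ (∉-φ i₁ j₁ c i₂∉c)) (cong φ₂ (φList-fresh cs i₁∉cs)) ⟩
    φ i₁ j₁ c ∷ φList i₂ j₂ cs ∎
    where φ₂ = φList i₂ j₂

  rhs : φList′ (correspondingEdge T (i₂ , j₂) (i₁ , j₁)) (φList i₂ j₂ (c ∷ cs))
        ≡ φ i₁ j₁ c ∷ φList i₂ j₂ cs
  rhs = begin
    φList′ (correspondingEdge T (i₂ , j₂) (i₁ , j₁)) (φList i₂ j₂ (c ∷ cs))
      ≡⟨ cong (λ f → φList′ f (φList i₂ j₂ (c ∷ cs)))
           (correspondingEdge-unrelated T (separate (edge-parent∈ e₁) (anyEdge-parent∈ e₂) ∘ sym)
                                          (separate (edge-child∈ e₁) (anyEdge-parent∈ e₂) ∘ sym)) ⟩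
    φ i₁ j₁ (φ i₂ j₂ c) ∷ φList i₁ j₁ (φList i₂ j₂ cs)
      ≡⟨ cong₂ _∷_ (cong (φ i₁ j₁) (φ-fresh c i₂∉c)) (φList-fresh _ (∉-φList i₂ j₂ cs i₁∉cs)) ⟩
    φ i₁ j₁ c ∷ φList i₂ j₂ cs ∎

edge-from-child : ∀ A L B {j k} → Unique (labelsList (A ++ node j L ∷ B)) →
  Any (λ c → Edge c j k) (A ++ node j L ∷ B) → Any (λ c → root c ≡ k) L
edge-from-child A L B {j} {k} u e = locate (Anyₚ.++⁻ A e)
  where
  j∉LB : j ∉ labelsList L ++ labelsList B
  j∉LB = Unique[x∷xs]⇒x∉xs (proj₂ (Unique-labelsList-++⁻ A u))
  locate : Any (λ c → Edge c j k) A ⊎ Any (λ c → Edge c j k) (node j L ∷ B) →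
    Any (λ c → root c ≡ k) L
  locate (inj₁ e∈A) = ⊥-elim (Unique-labelsList-++⇒disjoint A u (here refl) (anyEdge-parent∈ e∈A))
  locate (inj₂ (here (here r))) = r
  locate (inj₂ (here (there e∈L))) = ⊥-elim (j∉LB (∈-++⁺ˡ (anyEdge-parent∈ e∈L)))
  locate (inj₂ (there e∈B)) = ⊥-elim (j∉LB (∈-++⁺ʳ (labelsList L) (anyEdge-parent∈ e∈B)))

commute-root-edges : ∀ a cs → Unique (labels (node a cs)) → ∀ {j₁ j₂} → j₁ ≢ j₂ →
  Any (λ c → root c ≡ j₁) cs → Any (λ c → root c ≡ j₂) cs → Commute (node a cs) (a , j₁) (a , j₂)
commute-root-edges a cs u j₁≢j₂ p q with siblingView j₁≢j₂ p q
... | left-of A L₁ M L₂ C = commute-siblings a A L₁ M L₂ C u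
... | right-of A L₂ M L₁ C = sym (commute-siblings a A L₂ M L₁ C u)

commute-root-edge-deep-edge : ∀ a cs → Unique (labels (node a cs)) → ∀ {j₁ i₂ j₂} →
  Any (λ c → root c ≡ j₁) cs → Any (λ c → Edge c i₂ j₂) cs → Commute (node a cs) (a , j₁) (i₂ , j₂)
commute-root-edge-deep-edge a cs u {j₁} {i₂} p q with childView p | i₂ ≟ j₁
... | child A L B | no i₂≢j₁ =
  commute-root-edge-unrelated a A L B (a≢ (anyEdge-parent∈ q)) (a≢ (anyEdge-child∈ q)) (i₂≢j₁ ∘ sym)
    (Unique-labelsList-++⇒disjoint A (Unique.tail u) (here refl))
  where
  a≢ : ∀ {x} → x ∈ labelsList (A ++ node j₁ L ∷ B) → a ≢ x
  a≢ x∈ refl = Unique[x∷xs]⇒x∉xs u x∈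
... | child A L B | yes refl with childView (edge-from-child A L B (Unique.tail u) q)
...   | child P Q R = commute-path a A P Q R B u

commute-below-root : ∀ a cs {i₁ j₁ i₂ j₂} → a ∉ labelsList cs →
  Any (λ c → Edge c i₁ j₁) cs → Any (λ c → Edge c i₂ j₂) cs →
  CommuteIn (node a cs) cs (i₁ , j₁) (i₂ , j₂) → Commute (node a cs) (i₁ , j₁) (i₂ , j₂)
commute-below-root a cs {i₁} {j₁} {i₂} {j₂} a∉ e₁ e₂ below =
  trans (skip-root e₁ e₂) (trans (cong (node a) below) (sym (skip-root e₂ e₁)))
  where
  a≢ : ∀ {x} → x ∈ labelsList cs → a ≢ x
  a≢ x∈ refl = a∉ x∈
  skip-root : ∀ {i j k l} → Any (λ c → Edge c i j) cs → Any (λ c → Edge c k l) cs →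
    φ′ (correspondingEdge (node a cs) (i , j) (k , l)) (φ i j (node a cs))
      ≡ node a (φList′ (correspondingEdge (node a cs) (i , j) (k , l)) (φList i j cs))
  skip-root {i} {j} {k} {l} e f =
    trans (cong (φ′ _) (φ-skip cs (a≢ (anyEdge-parent∈ e))))
          (φ-skip _ (a≢ (correspondingEdge-parent∈ (node a cs) i j k l
                                                    (anyEdge-child∈ e) (anyEdge-parent∈ f))))

SameChildren : Tree → List Tree → Set
SameChildren T cs = ∀ {i} → i ∈ labelsList cs → childrenOf i T ≡ childrenOfList i cs

mutual
  commute : ∀ T → Unique (labels T) → ∀ {i₁ j₁ i₂ j₂} →
    Edge T i₁ j₁ → Edge T i₂ j₂ → Commute T (i₁ , j₁) (i₂ , j₂)
  commute (node a cs) u {j₁ = j₁} {j₂ = j₂} (here p) (here q) with j₁ ≟ j₂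
  ... | yes refl = refl
  ... | no j₁≢j₂ = commute-root-edges a cs u j₁≢j₂ p q
  commute (node a cs) u (here p) (there q) = commute-root-edge-deep-edge a cs u p q
  commute (node a cs) u (there p) (here q) = sym (commute-root-edge-deep-edge a cs u q p)
  commute (node a cs) u (there p) (there q) =
    commute-below-root a cs a∉ p q (commute-children (node a cs) cs (Unique.tail u) same p q)
    where
    a∉ : a ∉ labelsList cs
    a∉ = Unique[x∷xs]⇒x∉xs u
    same : SameChildren (node a cs) cs
    same i∈ = childrenOf-below {a = a} cs (λ { refl → a∉ i∈ })

  commute-children : ∀ T cs → Unique (labelsList cs) → SameChildren T cs → ∀ {i₁ j₁ i₂ j₂} →
    Any (λ c → Edge c i₁ j₁) cs → Any (λ c → Edge c i₂ j₂) cs → CommuteIn T cs (i₁ , j₁) (i₂ , j₂)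
  commute-children T (c ∷ cs) u same {i₁} {j₁} {i₂} {j₂} (here e₁) (here e₂) =
    cong₂ _∷_ head (trans (untouched e₁ e₂) (sym (untouched e₂ e₁)))
    where
    open ≡-Reasoning
    disjoint : ∀ {x} → x ∈ labels c → x ∉ labelsList cs
    disjoint = flip (Unique-++⇒disjoint (labels c) u)
    local : ∀ {i j} → Edge c i j → ∀ f →
      correspondingEdge T (i , j) f ≡ correspondingEdge c (i , j) f
    local e f = correspondingEdge-local {T} {c} f
      (trans (same (∈-++⁺ˡ (edge-parent∈ e)))
             (childrenOfList-head c cs (disjoint (edge-parent∈ e))))
    head : φ′ (correspondingEdge T (i₁ , j₁) (i₂ , j₂)) (φ i₁ j₁ c)
         ≡ φ′ (correspondingEdge T (i₂ , j₂) (i₁ , j₁)) (φ i₂ j₂ c)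
    head = begin
      φ′ (correspondingEdge T (i₁ , j₁) (i₂ , j₂)) (φ i₁ j₁ c)
        ≡⟨ cong (λ f → φ′ f (φ i₁ j₁ c)) (local e₁ (i₂ , j₂)) ⟩
      φ′ (correspondingEdge c (i₁ , j₁) (i₂ , j₂)) (φ i₁ j₁ c)
        ≡⟨ commute c (proj₁ (Unique-++⁻ (labels c) u)) e₁ e₂ ⟩
      φ′ (correspondingEdge c (i₂ , j₂) (i₁ , j₁)) (φ i₂ j₂ c)
        ≡⟨ cong (λ f → φ′ f (φ i₂ j₂ c)) (local e₂ (i₁ , j₁)) ⟨
      φ′ (correspondingEdge T (i₂ , j₂) (i₁ , j₁)) (φ i₂ j₂ c) ∎
    untouched : ∀ {i j k l} → Edge c i j → Edge c k l →
      φList′ (correspondingEdge T (i , j) (k , l)) (φList i j cs) ≡ cs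
    untouched {i} {j} {k} {l} e f = φList²-fresh cs (disjoint (edge-parent∈ e))
      (disjoint (correspondingEdge-parent∈ T i j k l (edge-child∈ e) (edge-parent∈ f)))
  commute-children T (c ∷ cs) u same (there p₁) (there p₂) =
    cong₂ _∷_ (trans (untouched p₁ p₂) (sym (untouched p₂ p₁)))
              (commute-children T cs (proj₂ (Unique-++⁻ (labels c) u)) same′ p₁ p₂)
    where
    disjoint : ∀ {x} → x ∈ labelsList cs → x ∉ labels c
    disjoint = Unique-++⇒disjoint (labels c) u
    same′ : SameChildren T cs
    same′ {i} i∈ = trans (same (∈-++⁺ʳ (labels c) i∈)) (childrenOfList-tail c cs (disjoint i∈))
    untouched : ∀ {i j k l} → Any (λ d → Edge d i j) cs → Any (λ d → Edge d k l) cs →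
      φ′ (correspondingEdge T (i , j) (k , l)) (φ i j c) ≡ c
    untouched {i} {j} {k} {l} e f = φ²-fresh c (disjoint (anyEdge-parent∈ e))
      (disjoint (correspondingEdge-parent∈ T i j k l (anyEdge-child∈ e) (anyEdge-parent∈ f)))
  commute-children T (c ∷ cs) u _ (here e₁) (there p₂) =
    commute-separate-children T c cs (flip (Unique-++⇒disjoint (labels c) u)) e₁ p₂
  commute-children T (c ∷ cs) u _ (there p₁) (here e₂) =
    sym (commute-separate-children T c cs (flip (Unique-++⇒disjoint (labels c) u)) e₂ p₁)

proposition2p2 : (T : Tree) → Unique (labels T) →
    (i₁ j₁ i₂ j₂ : ℕ) → Edge T i₁ j₁ → Edge T i₂ j₂ →
    φ′ (correspondingEdge T (i₁ , j₁) (i₂ , j₂)) (φ i₁ j₁ T)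
      ≡ φ′ (correspondingEdge T (i₂ , j₂) (i₁ , j₁)) (φ i₂ j₂ T)
proposition2p2 T u i₁ j₁ i₂ j₂ e₁ e₂ = commute T u e₁ e₂
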